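{- Let $G$ be an $n$-node directed unweighted graph with a set of demand pairs $P\subseteq V(G)\times V(G)$ of size $|P|=p$, and let $\pi(\cdot,\cdot)$ be a consistent tiebreaking scheme for $G,P$ such that every edge of $G$ lies on some path of $\pi(P)$ and every path $\pi\in\pi(P)$ satisfies $\widehat{\ell}/2\le|\pi|\le2\widehat{\ell}$. Let $d=\lceil|E(G)|/n\rceil$, $\ell=\lceil|E(G)|/p\rceil$, $\widehat{\ell}=\frac1p\sum_{\pi\in\pi(P)}|\pi|$, assume $d,\ell$ exceed a sufficiently large absolute constant and $d\ge 10p/n^{1/2}$. Let $S\subseteq V(G)$ be a set of nodes with $|S|=\Theta(d)$, $\deg_G(s)=\Omega(d)$ for all $s\in S$, and $\mathrm{dist}_G(s,t)=O(\widehat{\ell}p^2/(nd^2))$ for all $s,t\in S$. Let $Q\subseteq P$ be the set of demand pairs $(s,t)\in P$ such that $\pi(s,t)$ contains a node of $S$. Then $|Q|=\Omega(d^2)$.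
   Context: A tiebreaking scheme for $G,P$ fixes, for each $(s,t)\in P$, a shortest $s\leadsto t$ path $\pi(s,t)$ in $G$; $\pi(P)=\{\pi(s,t):(s,t)\in P\}$. It is consistent if for all $\pi_1,\pi_2\in\pi(P)$ and nodes $x,y$ such that $x$ precedes $y$ on both, $\pi_1[x\leadsto y]=\pi_2[x\leadsto y]$. $|\pi|$ is the number of edges of $\pi$; $\deg_G(v)$ is the total degree of $v$. The implicit constant in $\Omega(d^2)$ depends only on the implicit constants in the hypotheses on $S$. -}

module Defs where

open import Data.Nat using (ℕ; zero; suc; _+_; _*_; _∸_; _≤_; NonZero)
open import Data.Nat.DivMod using (_/_)
open import Data.Bool using (Bool; true; false; if_then_else_)
open import Data.Fin using (Fin; zero; suc)
open import Data.List using (List; []; _∷_; _++_)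
open import Data.Bool.ListAction using (any)
open import Data.Product using (Σ; ∃; ∃-syntax; _×_; _,_; proj₁; proj₂)
open import Relation.Binary.PropositionalEquality using (_≡_)

⌈_/_⌉ : ℕ → (b : ℕ) → {{NonZero b}} → ℕ
⌈ a / b ⌉ = (a + b ∸ 1) / b

count : ∀ {m} → (Fin m → Bool) → ℕ
count {zero}  f = 0
count {suc m} f = (if f zero then 1 else 0) + count (λ i → f (suc i))

sumFin : ∀ {m} → (Fin m → ℕ) → ℕ
sumFin {zero}  f = 0
sumFin {suc m} f = f zero + sumFin (λ i → f (suc i))

Graph : ℕ → Set
Graph n = Fin n → Fin n → Bool

module _ {n : ℕ} (G : Graph n) where

  numEdges : ℕ
  numEdges = sumFin (λ u → count (λ v → G u v))

  deg : Fin n → ℕ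
  deg v = count (λ w → G v w) + count (λ u → G u v)

  data Walk : Fin n → Fin n → Set where
    [_]    : (v : Fin n) → Walk v v
    _∷⟨_⟩_ : (u : Fin n) {v t : Fin n} → G u v ≡ true → Walk v t → Walk u t

  len : ∀ {s t} → Walk s t → ℕ
  len [ v ]          = 0
  len (u ∷⟨ e ⟩ w)   = suc (len w)

  nodes : ∀ {s t} → Walk s t → List (Fin n)
  nodes [ v ]        = v ∷ []
  nodes (u ∷⟨ e ⟩ w) = u ∷ nodes w

  IsShortest : ∀ {s t} → Walk s t → Set
  IsShortest {s} {t} w = (w' : Walk s t) → len w ≤ len w'

  DistLE : Fin n → Fin n → ℕ → Set
  DistLE s t k = Σ (Walk s t) (λ w → len w ≤ k)

  TieBreaking : ∀ {p} → (Fin p → Fin n × Fin n) → Set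
  TieBreaking {p} P = (i : Fin p) → Walk (proj₁ (P i)) (proj₂ (P i))

  module _ {p : ℕ} {P : Fin p → Fin n × Fin n} (π : TieBreaking P) where

    AllShortest : Set
    AllShortest = (i : Fin p) → IsShortest (π i)

    Consistent : Set
    Consistent = (i j : Fin p) (x y : Fin n)
      (α₁ β₁ γ₁ α₂ β₂ γ₂ : List (Fin n)) →
      nodes (π i) ≡ α₁ ++ (x ∷ β₁ ++ (y ∷ γ₁)) →
      nodes (π j) ≡ α₂ ++ (x ∷ β₂ ++ (y ∷ γ₂)) →
      β₁ ≡ β₂

    CoversEdges : Set
    CoversEdges = (u v : Fin n) → G u v ≡ true →
      ∃[ i ] ∃[ α ] ∃[ β ] (nodes (π i) ≡ α ++ (u ∷ v ∷ β))

    -- Σ_{π ∈ π(P)} |π|   (so that  ℓ̂ = totalLen / p)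
    totalLen : ℕ
    totalLen = sumFin (λ i → len (π i))

    sizeQ : (Fin n → Bool) → ℕ
    sizeQ S = count (λ i → any S (nodes (π i)))

{-# OPTIONS --safe #-}
-- Charge every edge (x, v) leaving a node x ∈ S to the first demand path on which v follows x,
-- and let r_i be the number of nodes of S charged to path i, so that Σ r_i ≥ outdeg(S).  If x
-- precedes x' on two paths, consistency makes the two paths share the whole segment from x to x',
-- in particular the successor of x; so two distinct nodes are charged together to at most two
-- paths (one for each order), and Σ r_i² ≤ 2|S|² + Σ r_i.  Only paths of Q carry charges, and
-- (1 + t) r ≤ t² + r², hence t · outdeg(S) ≤ t² |Q| + 2|S|².  The same argument on the reversed
-- paths bounds indeg(S).  With deg(S) ≥ |S| d / a₂ and d/a₁ ≤ |S| ≤ b₁ d, taking t = 1 + 4 a₂ b₁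
-- gives d² ≤ 2 a₁ a₂ t² |Q|.
module Submission where

open import Defs
open import Data.Bool using (Bool; true; false; if_then_else_; _∧_)
import Data.Bool.Properties as Boolₚ
open import Data.Bool.ListAction using (any)
open import Data.Fin as Fin using (Fin; zero; suc)
import Data.Fin.Properties as Finₚ
open import Data.List using (List; []; _∷_; _++_; _∷ʳ_; head; reverse; _ʳ++_)
open import Data.List.Properties using (∷ʳ-++; ++-conicalʳ; ++-ʳ++; ʳ++-defn; reverse-involutive; reverse-injective)
open import Data.List.Membership.Propositional using (_∈_; lose)
open import Data.List.Membership.Propositional.Properties using (∈-∃++)
open import Data.List.Relation.Unary.Any using (here; there)
open import Data.List.Relation.Unary.Any.Properties using (any⁺; reverse⁻)
open import Data.Maybe using (Maybe; just; nothing)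
import Data.Maybe.Properties as Maybeₚ
open import Data.Nat using (ℕ; zero; suc; _+_; _*_; _≤_; z≤n; s≤s; _≤?_; NonZero)
open import Data.Nat.Properties
open import Algebra.Properties.Semiring.Sum +-*-semiring
  using (sum; sum-syntax; sum-cong-≗; sum-replicate-zero; sum-remove; ∑-comm; ∑-distrib-+;
         *-distribˡ-sum; *-distribʳ-sum)
open import Data.Nat.Tactic.RingSolver using (solve-∀)
open import Data.Product using (∃-syntax; _×_; _,_; proj₁)
open import Data.Sum using (_⊎_; inj₁; inj₂; swap)
open import Function using (_∘_; flip)
open import Function.Bundles using (Equivalence)
open import Function.Definitions using (Injective)
open import Relation.Binary.Definitions using (DecidableEquality; tri<; tri≈; tri>)
open import Relation.Binary.PropositionalEquality
open import Relation.Nullary using (¬_; Dec; yes; no; does; contradiction)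
open import Relation.Nullary.Decidable using (dec-true; dec-false; _×-dec_; _→-dec_; ¬?)
open import Relation.Unary using (Decidable; _⊆_; _∪_)

𝟙 : Bool → ℕ
𝟙 b = if b then 1 else 0

𝟙-∧ : ∀ b c → 𝟙 (b ∧ c) ≡ 𝟙 b * 𝟙 c
𝟙-∧ false c = refl
𝟙-∧ true  c = sym (+-identityʳ (𝟙 c))

count≡∑𝟙 : ∀ {m} (f : Fin m → Bool) → count f ≡ ∑[ i < m ] 𝟙 (f i)
count≡∑𝟙 {zero}  f = refl
count≡∑𝟙 {suc m} f = cong (𝟙 (f zero) +_) (count≡∑𝟙 (f ∘ suc))

∑-mono-≤ : ∀ {m} {f g : Fin m → ℕ} → (∀ i → f i ≤ g i) → sum f ≤ sum g
∑-mono-≤ {zero}  f≤g = z≤n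
∑-mono-≤ {suc m} f≤g = +-mono-≤ (f≤g zero) (∑-mono-≤ (f≤g ∘ suc))

∑-zero : ∀ {m} {f : Fin m → ℕ} → (∀ i → f i ≡ 0) → sum f ≡ 0
∑-zero {m} f≡0 = trans (sum-cong-≗ f≡0) (sum-replicate-zero m)

term≤∑ : ∀ {m} (f : Fin m → ℕ) i → f i ≤ sum f
term≤∑ {suc m} f i = ≤-trans (m≤m+n (f i) _) (≤-reflexive (sym (sum-remove f)))

∑*∑ : ∀ {m k} (f : Fin m → ℕ) (g : Fin k → ℕ) →
      sum f * sum g ≡ ∑[ x < m ] ∑[ y < k ] (f x * g y)
∑*∑ f g = trans (*-distribʳ-sum (sum g) f) (sum-cong-≗ (λ x → *-distribˡ-sum (f x) g))

AtMostOne : ∀ {m} → (Fin m → Set) → Set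
AtMostOne A = ∀ {i j} → A i → A j → i ≡ j

AtMostOne-suc : ∀ {m} {A : Fin (suc m) → Set} → AtMostOne A → AtMostOne (A ∘ suc)
AtMostOne-suc A≤1 a a′ = Finₚ.suc-injective (A≤1 a a′)

∑𝟙≤1 : ∀ {m} {Q A : Fin m → Set} (Q? : Decidable Q) → Q ⊆ A → AtMostOne A →
       ∑[ i < m ] 𝟙 (does (Q? i)) ≤ 1
∑𝟙≤1 {zero}  Q? Q⊆A A≤1 = z≤n
∑𝟙≤1 {suc m} Q? Q⊆A A≤1 with Q? zero
... | yes q = s≤s (≤-reflexive (∑-zero λ i →
                cong 𝟙 (dec-false (Q? (suc i)) λ q′ → Finₚ.0≢1+n (A≤1 (Q⊆A q) (Q⊆A q′)))))
... | no _  = ∑𝟙≤1 (Q? ∘ suc) Q⊆A (AtMostOne-suc A≤1)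

tail-⊆-other : ∀ {m} {Q C D : Fin (suc m) → Set} → AtMostOne C → C zero →
               Q ⊆ C ∪ D → Q ∘ suc ⊆ D ∘ suc
tail-⊆-other C≤1 c Q⊆C∪D q with Q⊆C∪D q
... | inj₁ c′ = contradiction (C≤1 c c′) Finₚ.0≢1+n
... | inj₂ d  = d

∑𝟙≤2 : ∀ {m} {Q A B : Fin m → Set} (Q? : Decidable Q) → Q ⊆ A ∪ B →
       AtMostOne A → AtMostOne B → ∑[ i < m ] 𝟙 (does (Q? i)) ≤ 2
∑𝟙≤2 {zero}  Q? Q⊆A∪B A≤1 B≤1 = z≤n
∑𝟙≤2 {suc m} Q? Q⊆A∪B A≤1 B≤1 with Q? zero
... | no _  = ∑𝟙≤2 (Q? ∘ suc) Q⊆A∪B (AtMostOne-suc A≤1) (AtMostOne-suc B≤1)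
... | yes q with Q⊆A∪B q
...   | inj₁ a = s≤s (∑𝟙≤1 (Q? ∘ suc) (tail-⊆-other A≤1 a Q⊆A∪B) (AtMostOne-suc B≤1))
...   | inj₂ b = s≤s (∑𝟙≤1 (Q? ∘ suc) (tail-⊆-other B≤1 b (swap ∘ Q⊆A∪B)) (AtMostOne-suc A≤1))

𝟙-idem : ∀ b → 𝟙 b * 𝟙 b ≡ 𝟙 b
𝟙-idem false = refl
𝟙-idem true  = refl

𝟙*≤ : ∀ b {c d} → (b ≡ true → c ≤ d) → 𝟙 b * c ≤ d
𝟙*≤ false c≤d = z≤n
𝟙*≤ true  c≤d = ≤-trans (≤-reflexive (+-identityʳ _)) (c≤d refl)

∑δ*≤ : ∀ {n} (x : Fin n) c → ∑[ y < n ] (𝟙 (does (x Fin.≟ y)) * c) ≤ c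
∑δ*≤ {n} x c = begin
  ∑[ y < n ] (𝟙 (does (x Fin.≟ y)) * c) ≡⟨ *-distribʳ-sum c (λ y → 𝟙 (does (x Fin.≟ y))) ⟨
  ∑[ y < n ] 𝟙 (does (x Fin.≟ y)) * c   ≤⟨ *-monoˡ-≤ c (∑𝟙≤1 (x Fin.≟_) (λ x≡y → x≡y) (λ x≡y x≡z → trans (sym x≡y) x≡z)) ⟩
  1 * c                                 ≡⟨ *-identityˡ c ⟩
  c                                     ∎
  where open ≤-Reasoning

∑∑2*𝟙*𝟙≡2*count*count : ∀ {n} (w : Fin n → Bool) →
  ∑[ x < n ] ∑[ y < n ] (2 * (𝟙 (w x) * 𝟙 (w y))) ≡ 2 * (count w * count w)
∑∑2*𝟙*𝟙≡2*count*count {n} w = sym (begin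
  2 * (count w * count w)                         ≡⟨ cong (λ c → 2 * (c * c)) (count≡∑𝟙 w) ⟩
  2 * (∑[ x < n ] 𝟙 (w x) * ∑[ y < n ] 𝟙 (w y))  ≡⟨ cong (2 *_) (∑*∑ (𝟙 ∘ w) (𝟙 ∘ w)) ⟩
  2 * ∑[ x < n ] ∑[ y < n ] (𝟙 (w x) * 𝟙 (w y))  ≡⟨ *-distribˡ-sum 2 (λ x → ∑[ y < n ] (𝟙 (w x) * 𝟙 (w y))) ⟩
  ∑[ x < n ] (2 * ∑[ y < n ] (𝟙 (w x) * 𝟙 (w y))) ≡⟨ sum-cong-≗ (λ x → *-distribˡ-sum 2 (λ y → 𝟙 (w x) * 𝟙 (w y))) ⟩
  ∑[ x < n ] ∑[ y < n ] (2 * (𝟙 (w x) * 𝟙 (w y))) ∎)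
  where open ≡-Reasoning

∑-rowSum²≤ : ∀ {p n} (a : Fin p → Fin n → Bool) (w : Fin n → Bool) →
  (∀ {i x} → w x ≡ false → a i x ≡ false) →
  (∀ {x y} → x ≢ y → ∑[ i < p ] (𝟙 (a i x) * 𝟙 (a i y)) ≤ 2) →
  ∑[ i < p ] (∑[ x < n ] 𝟙 (a i x) * ∑[ x < n ] 𝟙 (a i x))
    ≤ 2 * (count w * count w) + ∑[ i < p ] ∑[ x < n ] 𝟙 (a i x)
∑-rowSum²≤ {p} {n} a w support pair≤2 = begin
  ∑[ i < p ] (row i * row i)
    ≡⟨ sum-cong-≗ (λ i → ∑*∑ (𝟙 ∘ a i) (𝟙 ∘ a i)) ⟩
  ∑[ i < p ] ∑[ x < n ] ∑[ y < n ] (𝟙 (a i x) * 𝟙 (a i y))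
    ≡⟨ ∑-comm (λ i x → ∑[ y < n ] (𝟙 (a i x) * 𝟙 (a i y))) ⟩
  ∑[ x < n ] ∑[ i < p ] ∑[ y < n ] (𝟙 (a i x) * 𝟙 (a i y))
    ≡⟨ sum-cong-≗ (λ x → ∑-comm (λ i y → 𝟙 (a i x) * 𝟙 (a i y))) ⟩
  ∑[ x < n ] ∑[ y < n ] ∑[ i < p ] (𝟙 (a i x) * 𝟙 (a i y))
    ≤⟨ ∑-mono-≤ (λ x → ∑-mono-≤ (pair-or-diagonal x)) ⟩
  ∑[ x < n ] ∑[ y < n ] (2 * (𝟙 (w x) * 𝟙 (w y)) + δ x y * col x)
    ≡⟨ sum-cong-≗ (λ x → ∑-distrib-+ (λ y → 2 * (𝟙 (w x) * 𝟙 (w y))) (λ y → δ x y * col x)) ⟩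
  ∑[ x < n ] (∑[ y < n ] (2 * (𝟙 (w x) * 𝟙 (w y))) + ∑[ y < n ] (δ x y * col x))
    ≡⟨ ∑-distrib-+ (λ x → ∑[ y < n ] (2 * (𝟙 (w x) * 𝟙 (w y)))) (λ x → ∑[ y < n ] (δ x y * col x)) ⟩
  ∑[ x < n ] ∑[ y < n ] (2 * (𝟙 (w x) * 𝟙 (w y))) + ∑[ x < n ] ∑[ y < n ] (δ x y * col x)
    ≤⟨ +-mono-≤ (≤-reflexive (∑∑2*𝟙*𝟙≡2*count*count w)) (∑-mono-≤ (λ x → ∑δ*≤ x (col x))) ⟩
  2 * (count w * count w) + ∑[ x < n ] col x
    ≡⟨ cong (2 * (count w * count w) +_) (∑-comm (λ x i → 𝟙 (a i x))) ⟩
  2 * (count w * count w) + ∑[ i < p ] row i ∎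
  where
  open ≤-Reasoning
  row : Fin p → ℕ
  row i = ∑[ x < n ] 𝟙 (a i x)
  col : Fin n → ℕ
  col x = ∑[ i < p ] 𝟙 (a i x)
  δ : Fin n → Fin n → ℕ
  δ x y = 𝟙 (does (x Fin.≟ y))

  pair-or-diagonal : ∀ x y → ∑[ i < p ] (𝟙 (a i x) * 𝟙 (a i y)) ≤ 2 * (𝟙 (w x) * 𝟙 (w y)) + δ x y * col x
  pair-or-diagonal x y with x Fin.≟ y
  ... | yes refl = ≤-trans (≤-reflexive (trans (sum-cong-≗ (λ i → 𝟙-idem (a i x))) (sym (*-identityˡ (col x)))))
                           (m≤n+m (1 * col x) (2 * (𝟙 (w x) * 𝟙 (w x))))
  ... | no  x≢y with w x in wx | w y in wy
  ...   | true  | true  = pair≤2 x≢y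
  ...   | false | _     = ≤-reflexive (∑-zero λ i → cong (λ b → 𝟙 b * 𝟙 (a i y)) (support wx))
  ...   | true  | false = ≤-reflexive (∑-zero λ i →
                            trans (cong (λ b → 𝟙 (a i x) * 𝟙 b) (support wy)) (*-zeroʳ (𝟙 (a i x))))

[1+t]*r≤t*t+r*r : ∀ t r → suc t * r ≤ t * t + r * r
[1+t]*r≤t*t+r*r t zero = ≤-trans (≤-reflexive (*-zeroʳ (suc t))) z≤n
[1+t]*r≤t*t+r*r t r@(suc _) with r ≤? t
... | yes r≤t = ≤-trans (+-mono-≤ (m≤m*n r r) (*-monoʳ-≤ t r≤t)) (≤-reflexive (+-comm (r * r) (t * t)))
... | no  r≰t = ≤-trans (*-monoˡ-≤ r (≰⇒> r≰t)) (m≤n+m (r * r) (t * t))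

[1+t]*∑r≤t*t*count+∑r*r : ∀ {p} t (r : Fin p → ℕ) (g : Fin p → Bool) → (∀ {i} → g i ≡ false → r i ≡ 0) →
  suc t * sum r ≤ t * t * count g + ∑[ i < p ] (r i * r i)
[1+t]*∑r≤t*t*count+∑r*r {p} t r g r≡0 = begin
  suc t * sum r                                            ≡⟨ *-distribˡ-sum (suc t) r ⟩
  ∑[ i < p ] (suc t * r i)                                 ≤⟨ ∑-mono-≤ pointwise ⟩
  ∑[ i < p ] (t * t * 𝟙 (g i) + r i * r i)                ≡⟨ ∑-distrib-+ (λ i → t * t * 𝟙 (g i)) (λ i → r i * r i) ⟩
  ∑[ i < p ] (t * t * 𝟙 (g i)) + ∑[ i < p ] (r i * r i)   ≡⟨ cong (_+ _) (*-distribˡ-sum (t * t) (𝟙 ∘ g)) ⟨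
  t * t * ∑[ i < p ] 𝟙 (g i) + ∑[ i < p ] (r i * r i)     ≡⟨ cong (λ c → t * t * c + _) (count≡∑𝟙 g) ⟨
  t * t * count g + ∑[ i < p ] (r i * r i)                ∎
  where
  open ≤-Reasoning
  pointwise : ∀ i → suc t * r i ≤ t * t * 𝟙 (g i) + r i * r i
  pointwise i with g i in gi
  ... | true  = subst (λ c → suc t * r i ≤ c + r i * r i) (sym (*-identityʳ (t * t))) ([1+t]*r≤t*t+r*r t (r i))
  ... | false rewrite r≡0 gi = ≤-trans (≤-reflexive (*-zeroʳ (suc t))) z≤n

Least : ∀ {m} → (Fin m → Set) → Fin m → Set
Least Q i = Q i × (∀ j → j Fin.< i → ¬ Q j)

least : ∀ {m} {Q : Fin m → Set} → Decidable Q → ∀ {i} → Q i → ∃[ k ] Least Q k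
least {suc m} Q? {i} q with Q? zero | i
... | yes q₀ | _     = zero , q₀ , λ _ ()
... | no ¬q₀ | zero  = contradiction q ¬q₀
... | no ¬q₀ | suc i with k , qk , k-least ← least (Q? ∘ suc) q =
  suc k , qk , λ { zero _ → ¬q₀ ; (suc j) (s≤s j<k) → k-least j j<k }

Least-unique : ∀ {m} {Q : Fin m → Set} {i j} → Least Q i → Least Q j → i ≡ j
Least-unique {i = i} {j} (qi , i-least) (qj , j-least) with Finₚ.<-cmp i j
... | tri< i<j _ _ = contradiction qi (j-least i i<j)
... | tri≈ _ i≡j _ = i≡j
... | tri> _ _ j<i = contradiction qj (i-least j j<i)

Least? : ∀ {m} {Q : Fin m → Set} → Decidable Q → Decidable (Least Q)
Least? Q? i = Q? i ×-dec Finₚ.all? (λ j → j Finₚ.<? i →-dec ¬? (Q? j))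

module _ {A : Set} where

  Precedes : A → A → List A → Set
  Precedes x y l = ∃[ α ] ∃[ β ] ∃[ γ ] (l ≡ α ++ (x ∷ β ++ (y ∷ γ)))

  SelfConsistent : List A → Set
  SelfConsistent l = ∀ x y α₁ β₁ γ₁ α₂ β₂ γ₂ →
    l ≡ α₁ ++ (x ∷ β₁ ++ (y ∷ γ₁)) → l ≡ α₂ ++ (x ∷ β₂ ++ (y ∷ γ₂)) → β₁ ≡ β₂

  ConsistentFamily : {I : Set} → (I → List A) → Set
  ConsistentFamily ℓ = ∀ i j x y α₁ β₁ γ₁ α₂ β₂ γ₂ →
    ℓ i ≡ α₁ ++ (x ∷ β₁ ++ (y ∷ γ₁)) → ℓ j ≡ α₂ ++ (x ∷ β₂ ++ (y ∷ γ₂)) → β₁ ≡ β₂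

  Covers : {I : Set} → (A → A → Bool) → (I → List A) → Set
  Covers E ℓ = ∀ u v → E u v ≡ true → ∃[ i ] ∃[ α ] ∃[ β ] (ℓ i ≡ α ++ (u ∷ v ∷ β))

  SelfConsistent-tail : ∀ a l → SelfConsistent (a ∷ l) → SelfConsistent l
  SelfConsistent-tail a l sc x y α₁ β₁ γ₁ α₂ β₂ γ₂ l≡₁ l≡₂ =
    sc x y (a ∷ α₁) β₁ γ₁ (a ∷ α₂) β₂ γ₂ (cong (a ∷_) l≡₁) (cong (a ∷_) l≡₂)

  ∈-∈-Precedes : ∀ {x y l} → x ∈ l → y ∈ l → x ≢ y → Precedes x y l ⊎ Precedes y x l
  ∈-∈-Precedes (here refl) (here refl)  x≢y = contradiction refl x≢y
  ∈-∈-Precedes (here refl) (there y∈l)  x≢y with β , γ , refl ← ∈-∃++ y∈l = inj₁ ([] , β , γ , refl)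
  ∈-∈-Precedes (there x∈l) (here refl)  x≢y with β , γ , refl ← ∈-∃++ x∈l = inj₂ ([] , β , γ , refl)
  ∈-∈-Precedes {l = a ∷ _} (there x∈l) (there y∈l) x≢y with ∈-∈-Precedes x∈l y∈l x≢y
  ... | inj₁ (α , β , γ , eq) = inj₁ (a ∷ α , β , γ , cong (a ∷_) eq)
  ... | inj₂ (α , β , γ , eq) = inj₂ (a ∷ α , β , γ , cong (a ∷_) eq)

  any-∈ : ∀ (P : A → Bool) {x l} → P x ≡ true → x ∈ l → any P l ≡ true
  any-∈ P Px x∈l = Equivalence.to Boolₚ.T-≡ (any⁺ P (lose x∈l (Equivalence.from Boolₚ.T-≡ Px)))

  reverse-split : ∀ α x β y (γ : List A) →
    reverse (α ++ (x ∷ β ++ (y ∷ γ))) ≡ reverse γ ++ (y ∷ reverse β ++ (x ∷ reverse α))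
  reverse-split α x β y γ = begin
    reverse (α ++ (x ∷ β ++ (y ∷ γ)))          ≡⟨ ++-ʳ++ α ⟩
    (β ++ (y ∷ γ)) ʳ++ (x ∷ reverse α)         ≡⟨ ++-ʳ++ β ⟩
    γ ʳ++ (y ∷ β ʳ++ (x ∷ reverse α))          ≡⟨ ʳ++-defn γ ⟩
    reverse γ ++ (y ∷ β ʳ++ (x ∷ reverse α))   ≡⟨ cong (λ m → reverse γ ++ (y ∷ m)) (ʳ++-defn β) ⟩
    reverse γ ++ (y ∷ reverse β ++ (x ∷ reverse α)) ∎
    where open ≡-Reasoning

  reverse-≡-split : ∀ {l α x β y γ} → reverse l ≡ α ++ (x ∷ β ++ (y ∷ γ)) →
    l ≡ reverse γ ++ (y ∷ reverse β ++ (x ∷ reverse α))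
  reverse-≡-split {l} {α} {x} {β} {y} {γ} eq =
    trans (sym (reverse-involutive l)) (trans (cong reverse eq) (reverse-split α x β y γ))

  ConsistentFamily-reverse : ∀ {I} {ℓ : I → List A} → ConsistentFamily ℓ → ConsistentFamily (reverse ∘ ℓ)
  ConsistentFamily-reverse consistent i j x y α₁ β₁ γ₁ α₂ β₂ γ₂ eq₁ eq₂ = reverse-injective
    (consistent i j y x _ (reverse β₁) _ _ (reverse β₂) _ (reverse-≡-split eq₁) (reverse-≡-split eq₂))

  Covers-reverse : ∀ {I} {E : A → A → Bool} {ℓ : I → List A} → Covers E ℓ → Covers (flip E) (reverse ∘ ℓ)
  Covers-reverse covers u v e with i , α , β , eq ← covers v u e =
    i , reverse β , reverse α , trans (cong reverse eq) (reverse-split α v [] u β)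

module Successor {A : Set} (_≟_ : DecidableEquality A) where

  successor : A → List A → Maybe A
  successor x []      = nothing
  successor x (y ∷ l) with x ≟ y
  ... | yes _ = head l
  ... | no  _ = successor x l

  successor-∈ : ∀ {x v} l → successor x l ≡ just v → x ∈ l
  successor-∈ {x} (y ∷ l) eq with x ≟ y
  ... | yes x≡y = here x≡y
  ... | no  _   = there (successor-∈ l eq)

  successor-∷ : ∀ {l} α x z γ → SelfConsistent l → l ≡ α ++ (x ∷ z ∷ γ) → successor x l ≡ just z
  successor-∷ []      x z γ sc refl with x ≟ x
  ... | yes _   = refl
  ... | no  x≢x = contradiction refl x≢x
  successor-∷ (a ∷ α) x z γ sc refl with x ≟ a
  ... | no  _    = successor-∷ α x z γ (SelfConsistent-tail a _ sc) refl
  -- an earlier x would precede z both directly and with the middle segment α ∷ʳ x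
  ... | yes refl with () ← ++-conicalʳ α (x ∷ [])
        (sc x z [] (α ∷ʳ x) γ (x ∷ α) [] γ (cong (x ∷_) (sym (∷ʳ-++ α x (z ∷ γ)))) refl)

  successor-Precedes : ∀ {l} α x β y γ → SelfConsistent l → l ≡ α ++ (x ∷ β ++ (y ∷ γ)) →
    successor x l ≡ head (β ∷ʳ y)
  successor-Precedes α x []      y γ = successor-∷ α x y γ
  successor-Precedes α x (b ∷ β) y γ = successor-∷ α x b (β ++ (y ∷ γ))

outDegreeSum : ∀ {n} → (Fin n → Fin n → Bool) → (Fin n → Bool) → ℕ
outDegreeSum {n} E S = ∑[ x < n ] (𝟙 (S x) * count (E x))

module Charging {n p : ℕ} (E : Fin n → Fin n → Bool) (ℓ : Fin p → List (Fin n))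
  (consistent : ConsistentFamily ℓ) (covers : Covers E ℓ) (S : Fin n → Bool) where

  open Successor (Fin._≟_ {n})

  FirstWithSuccessor : Fin n → Fin n → Fin p → Set
  FirstWithSuccessor x v = Least (λ j → successor x (ℓ j) ≡ just v)

  firstWithSuccessor? : ∀ x v → Decidable (FirstWithSuccessor x v)
  firstWithSuccessor? x v = Least? (λ j → Maybeₚ.≡-dec Fin._≟_ (successor x (ℓ j)) (just v))

  Charged : Fin p → Fin n → Set
  Charged i x = S x ≡ true × ∃[ v ] FirstWithSuccessor x v i

  charged? : ∀ i x → Dec (Charged i x)
  charged? i x = S x Boolₚ.≟ true ×-dec Finₚ.any? (λ v → firstWithSuccessor? x v i)

  charged : Fin p → Fin n → Bool
  charged i x = does (charged? i x)

  load : Fin p → ℕ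
  load i = ∑[ x < n ] 𝟙 (charged i x)

  firstWithSuccessor : ∀ {x v} → E x v ≡ true → ∃[ i ] FirstWithSuccessor x v i
  firstWithSuccessor {x} {v} e with i , α , β , eq ← covers x v e =
    least (λ j → Maybeₚ.≡-dec Fin._≟_ (successor x (ℓ j)) (just v))
          (successor-∷ α x v β (consistent i i) eq)

  outDegree≤charges : ∀ {x} → S x ≡ true → count (E x) ≤ ∑[ i < p ] 𝟙 (charged i x)
  outDegree≤charges {x} Sx = begin
    count (E x)                                                ≡⟨ count≡∑𝟙 (E x) ⟩
    ∑[ v < n ] 𝟙 (E x v)                                       ≤⟨ ∑-mono-≤ edge≤firsts ⟩
    ∑[ v < n ] ∑[ i < p ] 𝟙 (does (firstWithSuccessor? x v i)) ≡⟨ ∑-comm (λ v i → 𝟙 (does (firstWithSuccessor? x v i))) ⟩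
    ∑[ i < p ] ∑[ v < n ] 𝟙 (does (firstWithSuccessor? x v i)) ≤⟨ ∑-mono-≤ firsts≤charged ⟩
    ∑[ i < p ] 𝟙 (charged i x)                                 ∎
    where
    open ≤-Reasoning
    edge≤firsts : ∀ v → 𝟙 (E x v) ≤ ∑[ i < p ] 𝟙 (does (firstWithSuccessor? x v i))
    edge≤firsts v with E x v in e
    ... | false = z≤n
    ... | true with i , first ← firstWithSuccessor e =
      subst (_≤ _) (cong 𝟙 (dec-true (firstWithSuccessor? x v i) first)) (term≤∑ (λ j → 𝟙 (does (firstWithSuccessor? x v j))) i)
    firsts≤charged : ∀ i → ∑[ v < n ] 𝟙 (does (firstWithSuccessor? x v i)) ≤ 𝟙 (does (charged? i x))
    firsts≤charged i with charged? i x
    ... | yes c = subst (_ ≤_) (cong 𝟙 (sym (dec-true (charged? i x) c)))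
                    (∑𝟙≤1 (λ v → firstWithSuccessor? x v i) (λ first → first)
                      (λ first first′ → Maybeₚ.just-injective (trans (sym (proj₁ first)) (proj₁ first′))))
    ... | no ¬c = ≤-trans (≤-reflexive (∑-zero λ v →
                    cong 𝟙 (dec-false (firstWithSuccessor? x v i) λ first → ¬c (Sx , v , first)))) z≤n

  outDegreeSum≤∑load : outDegreeSum E S ≤ ∑[ i < p ] load i
  outDegreeSum≤∑load = ≤-trans (∑-mono-≤ pointwise) (≤-reflexive (∑-comm (λ x i → 𝟙 (charged i x))))
    where
    pointwise : ∀ x → 𝟙 (S x) * count (E x) ≤ ∑[ i < p ] 𝟙 (charged i x)
    pointwise x = 𝟙*≤ (S x) outDegree≤charges

  Charged-∈ : ∀ {i x} → Charged i x → x ∈ ℓ i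
  Charged-∈ {i} (_ , _ , successor≡ , _) = successor-∈ (ℓ i) successor≡

  uncharged : ∀ {i x} → S x ≡ false → charged i x ≡ false
  uncharged {i} {x} Sx = dec-false (charged? i x) (Boolₚ.not-¬ Sx ∘ proj₁)

  Charged-Precedes-unique : ∀ {x y} → AtMostOne (λ i → Charged i x × Precedes x y (ℓ i))
  Charged-Precedes-unique {x} {y} {i} {j} ((_ , v , firstᵢ) , α₁ , β , γ₁ , eq₁) ((_ , w , firstⱼ) , α₂ , β₂ , γ₂ , eq₂)
    with refl ← consistent i j x y α₁ β γ₁ α₂ β₂ γ₂ eq₁ eq₂ =
    Least-unique firstᵢ (subst (λ u → FirstWithSuccessor x u j) (sym v≡w) firstⱼ)
    where
    v≡w : v ≡ w
    v≡w = Maybeₚ.just-injective (begin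
      just v                ≡⟨ proj₁ firstᵢ ⟨
      successor x (ℓ i)     ≡⟨ successor-Precedes α₁ x β y γ₁ (consistent i i) eq₁ ⟩
      head (β ∷ʳ y)         ≡⟨ successor-Precedes α₂ x β y γ₂ (consistent j j) eq₂ ⟨
      successor x (ℓ j)     ≡⟨ proj₁ firstⱼ ⟩
      just w                ∎)
      where open ≡-Reasoning

  charged-pairs : ∀ {x y} → x ≢ y → ∑[ i < p ] (𝟙 (charged i x) * 𝟙 (charged i y)) ≤ 2
  charged-pairs {x} {y} x≢y = begin
    ∑[ i < p ] (𝟙 (charged i x) * 𝟙 (charged i y))   ≡⟨ sum-cong-≗ (λ i → 𝟙-∧ (charged i x) (charged i y)) ⟨
    ∑[ i < p ] 𝟙 (does (charged? i x ×-dec charged? i y))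
      ≤⟨ ∑𝟙≤2 (λ i → charged? i x ×-dec charged? i y) ordered Charged-Precedes-unique Charged-Precedes-unique ⟩
    2 ∎
    where
    open ≤-Reasoning
    ordered : ∀ {i} → Charged i x × Charged i y →
              (Charged i x × Precedes x y (ℓ i)) ⊎ (Charged i y × Precedes y x (ℓ i))
    ordered (cx , cy) with ∈-∈-Precedes (Charged-∈ cx) (Charged-∈ cy) x≢y
    ... | inj₁ x≺y = inj₁ (cx , x≺y)
    ... | inj₂ y≺x = inj₂ (cy , y≺x)

  unloaded : ∀ {i} (g : Fin p → Bool) → (∀ {x} → S x ≡ true → x ∈ ℓ i → g i ≡ true) →
             g i ≡ false → load i ≡ 0
  unloaded {i} g marks gi = ∑-zero λ x →
    cong 𝟙 (dec-false (charged? i x) λ c → Boolₚ.not-¬ gi (marks (proj₁ c) (Charged-∈ c)))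

  charging-bound : ∀ t (g : Fin p → Bool) → (∀ {i x} → S x ≡ true → x ∈ ℓ i → g i ≡ true) →
    t * outDegreeSum E S ≤ t * t * count g + 2 * (count S * count S)
  charging-bound t g marks = +-cancelˡ-≤ R _ _ (begin
    R + t * outDegreeSum E S                         ≤⟨ +-monoʳ-≤ R (*-monoʳ-≤ t outDegreeSum≤∑load) ⟩
    suc t * R                                        ≤⟨ [1+t]*∑r≤t*t*count+∑r*r t load g (unloaded g marks) ⟩
    t * t * count g + ∑[ i < p ] (load i * load i)   ≤⟨ +-monoʳ-≤ (t * t * count g) (∑-rowSum²≤ charged S uncharged charged-pairs) ⟩
    t * t * count g + (2 * (count S * count S) + R)  ≡⟨ rearrange (t * t * count g) (2 * (count S * count S)) R ⟩
    R + (t * t * count g + 2 * (count S * count S))  ∎)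
    where
    open ≤-Reasoning
    R : ℕ
    R = ∑[ i < p ] load i
    rearrange : ∀ a b c → a + (b + c) ≡ c + (a + b)
    rearrange = solve-∀

count*≤∑𝟙* : ∀ {n} (S : Fin n → Bool) (f : Fin n → ℕ) d → (∀ x → S x ≡ true → d ≤ f x) →
  count S * d ≤ ∑[ x < n ] (𝟙 (S x) * f x)
count*≤∑𝟙* {n} S f d d≤f = begin
  count S * d               ≡⟨ cong (_* d) (count≡∑𝟙 S) ⟩
  ∑[ x < n ] 𝟙 (S x) * d    ≡⟨ *-distribʳ-sum d (𝟙 ∘ S) ⟩
  ∑[ x < n ] (𝟙 (S x) * d)  ≤⟨ ∑-mono-≤ pointwise ⟩
  ∑[ x < n ] (𝟙 (S x) * f x) ∎
  where
  open ≤-Reasoning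
  pointwise : ∀ x → 𝟙 (S x) * d ≤ 𝟙 (S x) * f x
  pointwise x with S x in Sx
  ... | false = z≤n
  ... | true  = +-monoˡ-≤ 0 (d≤f x Sx)

∑𝟙*deg≡out+in : ∀ {n} (G : Graph n) (S : Fin n → Bool) a →
  ∑[ x < n ] (𝟙 (S x) * (a * deg G x)) ≡ a * (outDegreeSum G S + outDegreeSum (flip G) S)
∑𝟙*deg≡out+in {n} G S a = begin
  ∑[ x < n ] (𝟙 (S x) * (a * deg G x))
    ≡⟨ sum-cong-≗ (λ x → distribute (𝟙 (S x)) a (count (G x)) (count (flip G x))) ⟩
  ∑[ x < n ] (a * (𝟙 (S x) * count (G x)) + a * (𝟙 (S x) * count (flip G x)))
    ≡⟨ ∑-distrib-+ (λ x → a * (𝟙 (S x) * count (G x))) (λ x → a * (𝟙 (S x) * count (flip G x))) ⟩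
  ∑[ x < n ] (a * (𝟙 (S x) * count (G x))) + ∑[ x < n ] (a * (𝟙 (S x) * count (flip G x)))
    ≡⟨ cong₂ _+_ (*-distribˡ-sum a (λ x → 𝟙 (S x) * count (G x))) (*-distribˡ-sum a (λ x → 𝟙 (S x) * count (flip G x))) ⟨
  a * outDegreeSum G S + a * outDegreeSum (flip G) S
    ≡⟨ *-distribˡ-+ a (outDegreeSum G S) (outDegreeSum (flip G) S) ⟨
  a * (outDegreeSum G S + outDegreeSum (flip G) S) ∎
  where
  open ≡-Reasoning
  distribute : ∀ s a o i → s * (a * (o + i)) ≡ a * (s * o) + a * (s * i)
  distribute = solve-∀

-- Any t > 4 a₂ b₁ works: the error terms 2 m² for out- and in-edges cost a₂ · 4 m² ≤ 4 a₂ b₁ · m d.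
scale : ℕ → ℕ → ℕ
scale a₂ b₁ = suc (4 * (a₂ * b₁))

m*d≤2*a₂*t*t*q : ∀ a₂ b₁ {m d q O₁ O₂} → let t = scale a₂ b₁ in
  t * O₁ ≤ t * t * q + 2 * (m * m) → t * O₂ ≤ t * t * q + 2 * (m * m) →
  m * d ≤ a₂ * (O₁ + O₂) → m ≤ b₁ * d → m * d ≤ 2 * a₂ * t * t * q
m*d≤2*a₂*t*t*q a₂ b₁ {m} {d} {q} {O₁} {O₂} out≤ in≤ m*d≤ m≤b₁*d = +-cancelʳ-≤ (k * (m * d)) (m * d) Y (begin
  m * d + k * (m * d)                             ≡⟨⟩
  t * (m * d)                                     ≤⟨ *-monoʳ-≤ t m*d≤ ⟩
  t * (a₂ * (O₁ + O₂))                            ≡⟨ e₁ t a₂ O₁ O₂ ⟩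
  a₂ * (t * O₁ + t * O₂)                          ≤⟨ *-monoʳ-≤ a₂ (+-mono-≤ out≤ in≤) ⟩
  a₂ * (t * t * q + 2 * (m * m) + (t * t * q + 2 * (m * m))) ≡⟨ e₂ a₂ t q m ⟩
  Y + 4 * a₂ * (m * m)                            ≤⟨ +-monoʳ-≤ Y (*-monoʳ-≤ (4 * a₂) (*-monoʳ-≤ m m≤b₁*d)) ⟩
  Y + 4 * a₂ * (m * (b₁ * d))                     ≡⟨ cong (Y +_) (e₃ a₂ b₁ m d) ⟩
  Y + k * (m * d)                                 ∎)
  where
  open ≤-Reasoning
  t = scale a₂ b₁
  k = 4 * (a₂ * b₁)
  Y = 2 * a₂ * t * t * q
  e₁ : ∀ t a o₁ o₂ → t * (a * (o₁ + o₂)) ≡ a * (t * o₁ + t * o₂)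
  e₁ = solve-∀
  e₂ : ∀ a t q m → a * (t * t * q + 2 * (m * m) + (t * t * q + 2 * (m * m))) ≡ 2 * a * t * t * q + 4 * a * (m * m)
  e₂ = solve-∀
  e₃ : ∀ a b m d → 4 * a * (m * (b * d)) ≡ 4 * (a * b) * (m * d)
  e₃ = solve-∀

pathsMeeting : ∀ {n p} → (Fin n → Bool) → (Fin p → List (Fin n)) → ℕ
pathsMeeting S ℓ = count (λ i → any S (ℓ i))

d*d≤c*pathsMeeting : ∀ {n p} (E : Graph n) (ℓ : Fin p → List (Fin n)) → ConsistentFamily ℓ → Covers E ℓ →
  (S : Fin n → Bool) (a₁ b₁ a₂ d : ℕ) → d ≤ a₁ * count S → count S ≤ b₁ * d →
  ((s : Fin n) → S s ≡ true → d ≤ a₂ * deg E s) →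
  d * d ≤ a₁ * (2 * a₂ * scale a₂ b₁ * scale a₂ b₁) * pathsMeeting S ℓ
d*d≤c*pathsMeeting E ℓ consistent covers S a₁ b₁ a₂ d d≤a₁*m m≤b₁*d d≤a₂*deg = begin
  d * d                      ≤⟨ *-monoˡ-≤ d d≤a₁*m ⟩
  a₁ * m * d                 ≡⟨ *-assoc a₁ m d ⟩
  a₁ * (m * d)               ≤⟨ *-monoʳ-≤ a₁ (m*d≤2*a₂*t*t*q a₂ b₁ out≤ in≤ degrees m≤b₁*d) ⟩
  a₁ * (2 * a₂ * t * t * q)  ≡⟨ *-assoc a₁ (2 * a₂ * t * t) q ⟨
  a₁ * (2 * a₂ * t * t) * q  ∎
  where
  open ≤-Reasoning
  t = scale a₂ b₁
  m = count S
  q = pathsMeeting S ℓ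
  out≤ = Charging.charging-bound E ℓ consistent covers S t (λ i → any S (ℓ i)) (any-∈ S)
  in≤  = Charging.charging-bound (flip E) (reverse ∘ ℓ) (ConsistentFamily-reverse consistent)
           (Covers-reverse covers) S t (λ i → any S (ℓ i)) (λ {i} Sx x∈ → any-∈ S Sx (reverse⁻ {xs = ℓ i} x∈))
  degrees : m * d ≤ a₂ * (outDegreeSum E S + outDegreeSum (flip E) S)
  degrees = ≤-trans (count*≤∑𝟙* S _ d d≤a₂*deg) (≤-reflexive (∑𝟙*deg≡out+in E S a₂))

lemma5p3 : ∃[ K ] ((a₁ b₁ a₂ b₃ : ℕ) → ∃[ c ]
    ((n : ℕ) {{_ : NonZero n}} (G : Graph n)
     (p : ℕ) {{_ : NonZero p}} (P : Fin p → Fin n × Fin n) → Injective _≡_ _≡_ P →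
     (π : TieBreaking G P) → AllShortest G π → Consistent G π → CoversEdges G π →
     ((i : Fin p) → totalLen G π ≤ 2 * p * len G (π i) × p * len G (π i) ≤ 2 * totalLen G π) →
     K ≤ ⌈ numEdges G / n ⌉ → K ≤ ⌈ numEdges G / p ⌉ →
     100 * (p * p) ≤ ⌈ numEdges G / n ⌉ * ⌈ numEdges G / n ⌉ * n →
     (S : Fin n → Bool) →
     ⌈ numEdges G / n ⌉ ≤ a₁ * count S → count S ≤ b₁ * ⌈ numEdges G / n ⌉ →
     ((s : Fin n) → S s ≡ true → ⌈ numEdges G / n ⌉ ≤ a₂ * deg G s) →
     ((s t : Fin n) → S s ≡ true → S t ≡ true →
       ∃[ w ] (len G {s} {t} w * (n * (⌈ numEdges G / n ⌉ * ⌈ numEdges G / n ⌉)) ≤ b₃ * (totalLen G π * p))) →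
     ⌈ numEdges G / n ⌉ * ⌈ numEdges G / n ⌉ ≤ c * sizeQ G π S))
lemma5p3 = 0 , λ a₁ b₁ a₂ _ → a₁ * (2 * a₂ * scale a₂ b₁ * scale a₂ b₁) ,
  λ n G p P _ π _ consistent covers _ _ _ _ S d≤a₁*m m≤b₁*d d≤a₂*deg _ →
    d*d≤c*pathsMeeting G (λ i → nodes G (π i)) consistent covers S a₁ b₁ a₂ _ d≤a₁*m m≤b₁*d d≤a₂*deg
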